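{- Let $a,b$ be non-negative integers, and let $G(a,b)$ be the number of matrices with non-negative integer entries and an arbitrary number $r\ge1$ of rows, $(m_{i,1}\ m_{i,2})_{1\le i\le r}$, such that $0\le m_{i,1}\le a$ and $0\le m_{i,2}\le b$ for all $i$, and: if $r=1$ then $m_{1,1}>0$ and $m_{1,2}<b$; if $r\ge 2$ then $m_{i,1}>m_{j,1}$ and $m_{i,1}+m_{i,2}<m_{j,1}+m_{j,2}$ for all $1\le i<j\le r$. Then $$G(a,b)=\sum_{i=0}^{a}\sum_{k=0}^{i-1}\binom{b}{k+2}+ab.$$
   Context: Binomial coefficients satisfy $\binom{m}{k}=0$ when $k>m$; empty sums equal $0$. -}

module Defs where

open import Data.Nat using (ℕ; zero; suc; _+_; _*_; _≤_; _<_)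
open import Data.Nat.Combinatorics using (_C_)
open import Data.Product using (_×_; _,_)
open import Data.Empty using (⊥)
open import Data.List using (List; []; _∷_; map; upTo)
open import Data.Nat.ListAction using (sum)
open import Data.List.Relation.Unary.All using (All)
open import Data.List.Relation.Unary.AllPairs using (AllPairs)

-- A matrix with r rows and 2 columns: the list of its rows (m_{i,1}, m_{i,2}), i = 1..r.
Row : Set
Row = ℕ × ℕ

InBox : ℕ → ℕ → Row → Set
InBox a b (x , y) = x ≤ a × y ≤ b

Before : Row → Row → Set
Before (x , y) (x' , y') = x' < x × x + y < x' + y'

Valid : ℕ → ℕ → List Row → Set
Valid a b [] = ⊥
Valid a b ((x , y) ∷ []) = InBox a b (x , y) × 0 < x × y < b
Valid a b rows@(_ ∷ _ ∷ _) = All (InBox a b) rows × AllPairs Before rows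

rhs : ℕ → ℕ → ℕ
rhs a b = sum (map (λ i → sum (map (λ k → b C (k + 2)) (upTo i))) (upTo (suc a))) + a * b

-- Read bottom-up, a matrix with r ≥ 2 rows is a chain of points (x , y) of the box
-- [0,a] × [0,b] along which x strictly increases and x + y strictly decreases (hence so
-- does y).  Chains are counted by peeling off their first point.  If it lies off the
-- y-axis, the whole chain is a translate x ↦ x + 1 of a chain in a narrower box.  In the
-- box [0,a] × [0,b+1], a chain starting at (0 , y) with y ≤ b lives in [0,a] × [0,b],
-- and one starting at (0 , b+1) continues with a translate of a chain in the trapezoid
-- x < a, x + y < b.  A chain in a trapezoid is likewise a translate, a single point on
-- the axis, or a chain starting on the axis.  Pascal's rule turns these recursions into
-- the counts Σ_{k<i} C(b, k+2) for chains of length ≥ 2 starting on the axis of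
-- [0,i] × [0,b], and Σ_{k<i} C(c, k+1) for nonempty chains in the trapezoid x < i,
-- x + y < c.  Summing the former over the x-coordinate i of the first point gives the
-- double sum, and the single-row matrices are the a b pairs 0 < x ≤ a, y < b.

module Submission where

open import Defs
open import Data.Nat using (ℕ; zero; suc; _+_; _*_; _≤_; _<_; z≤n; s≤s; s≤s⁻¹)
open import Data.Nat.Properties
open import Algebra.Properties.CommutativeSemigroup +-commutativeSemigroup
  using () renaming (interchange to +-interchange)
open import Data.Nat.Combinatorics using (_C_; nCk+nC[k+1]≡[n+1]C[k+1]; nC1≡n)
open import Data.Nat.ListAction using (sum)
open import Data.Nat.ListAction.Properties using (sum-++)
open import Data.Product using (Σ; ∃; _×_; _,_; proj₁; proj₂)
import Data.Product as Product
open import Data.Product.Function.NonDependent.Propositional using (_×-⇔_)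
open import Data.Sum using (_⊎_; inj₁; inj₂)
import Data.Sum as Sum
open import Data.Empty using (⊥; ⊥-elim)
open import Data.List
  using (List; []; _∷_; [_]; length; map; upTo; reverse; _++_; cartesianProduct)
open import Data.List.Properties
  using (length-++; length-map; length-upTo; length-reverse; map-cong; map-++; map-applyUpTo;
         map-injective; ∷-injectiveˡ; ∷-injectiveʳ; upTo-∷ʳ; unfold-reverse;
         reverse-involutive; reverse-injective)
open import Data.List.Membership.Propositional using (_∈_)
open import Data.List.Membership.Propositional.Properties
  using (∈-map⁺; ∈-map⁻; ∈-++⁺ˡ; ∈-++⁺ʳ; ∈-++⁻; ∈-upTo⁺; ∈-upTo⁻;
         ∈-cartesianProduct⁺; ∈-cartesianProduct⁻)
open import Data.List.Relation.Unary.All as All using (All; []; _∷_)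
import Data.List.Relation.Unary.All.Properties as Allₚ
open import Data.List.Relation.Unary.AllPairs as AllPairs using (AllPairs; []; _∷_)
import Data.List.Relation.Unary.AllPairs.Properties as AllPairsₚ
open import Data.List.Relation.Unary.Unique.Propositional using (Unique)
import Data.List.Relation.Unary.Unique.Propositional.Properties as Uniqueₚ
open import Data.List.Relation.Binary.Permutation.Propositional using (↭-sym)
open import Data.List.Relation.Binary.Permutation.Propositional.Properties
  using (All-resp-↭; ↭-reverse)
open import Function using (_∘_; id; flip)
open import Function.Bundles using (_⇔_; mk⇔; Equivalence)
open import Function.Definitions using (Injective)
open import Function.Properties.Equivalence using () renaming (trans to ⇔-trans; sym to ⇔-sym)
open import Relation.Nullary using (¬_)
open import Relation.Binary.PropositionalEquality
  using (_≡_; refl; sym; trans; cong; cong₂; subst; module ≡-Reasoning)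

open Equivalence using (to; from)

private
  variable
    A B : Set
    P Q : A → Set
    m n : ℕ

Enumeration : (A → Set) → ℕ → Set
Enumeration {A} P n =
  Σ (List A) λ xs → Unique xs × ((x : A) → (x ∈ xs) ⇔ P x) × length xs ≡ n

Image : (A → B) → (A → Set) → B → Set
Image f P y = ∃ λ x → P x × f x ≡ y

enum-⇔ : (∀ x → P x ⇔ Q x) → Enumeration P n → Enumeration Q n
enum-⇔ P⇔Q (xs , xs! , ∈xs , |xs|) = xs , xs! , (λ x → ⇔-trans (∈xs x) (P⇔Q x)) , |xs|

enum-∅ : (∀ x → ¬ P x) → Enumeration P 0
enum-∅ ¬P = [] , [] , (λ x → mk⇔ (λ ()) (⊥-elim ∘ ¬P x)) , refl

enum-⊎ : (∀ {x} → P x → ¬ Q x) → Enumeration P m → Enumeration Q n →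
         Enumeration (λ x → P x ⊎ Q x) (m + n)
enum-⊎ disjoint (xs , xs! , ∈xs , |xs|) (ys , ys! , ∈ys , |ys|) =
  xs ++ ys ,
  Uniqueₚ.++⁺ xs! ys! (λ (x∈xs , x∈ys) → disjoint (to (∈xs _) x∈xs) (to (∈ys _) x∈ys)) ,
  (λ x → mk⇔ (Sum.map (to (∈xs x)) (to (∈ys x)) ∘ ∈-++⁻ xs)
             Sum.[ ∈-++⁺ˡ ∘ from (∈xs x) , ∈-++⁺ʳ xs ∘ from (∈ys x) ]) ,
  trans (length-++ xs) (cong₂ _+_ |xs| |ys|)

enum-map : {P : A → Set} {f : A → B} →
           Injective _≡_ _≡_ f → Enumeration P n → Enumeration (Image f P) n
enum-map {P = P} {f = f} f-injective (xs , xs! , ∈xs , |xs|) =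
  map f xs , Uniqueₚ.map⁺ f-injective xs! , (λ y → mk⇔ (image y) (∈-image y)) ,
  trans (length-map f xs) |xs|
  where
  image : ∀ y → y ∈ map f xs → Image f P y
  image y y∈ with x , x∈xs , refl ← ∈-map⁻ f y∈ = x , to (∈xs x) x∈xs , refl
  ∈-image : ∀ y → Image f P y → y ∈ map f xs
  ∈-image y (x , Px , refl) = ∈-map⁺ f (from (∈xs x) Px)

enum-upTo : ∀ n → Enumeration (_< n) n
enum-upTo n = upTo n , Uniqueₚ.upTo⁺ n , (λ k → mk⇔ ∈-upTo⁻ ∈-upTo⁺) , length-upTo n

length-cartesianProduct : (xs : List A) (ys : List B) →
                          length (cartesianProduct xs ys) ≡ length xs * length ys
length-cartesianProduct []       ys = refl
length-cartesianProduct (x ∷ xs) ys =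
  trans (length-++ (map (x ,_) ys))
        (cong₂ _+_ (length-map (x ,_) ys) (length-cartesianProduct xs ys))

enum-× : Enumeration P m → Enumeration Q n →
         Enumeration (λ xy → P (proj₁ xy) × Q (proj₂ xy)) (m * n)
enum-× (xs , xs! , ∈xs , |xs|) (ys , ys! , ∈ys , |ys|) =
  cartesianProduct xs ys , Uniqueₚ.cartesianProduct⁺ xs! ys! ,
  (λ (x , y) → mk⇔ (Product.map (to (∈xs x)) (to (∈ys y)) ∘ ∈-cartesianProduct⁻ xs ys)
                   (λ (Px , Qy) → ∈-cartesianProduct⁺ (from (∈xs x) Px) (from (∈ys y) Qy))) ,
  trans (length-cartesianProduct xs ys) (cong₂ _*_ |xs| |ys|)

enum-positive≤ : ∀ n → Enumeration (λ x → 0 < x × x ≤ n) n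
enum-positive≤ n = enum-⇔ (λ x → mk⇔ unsuc (suc⁺ x)) (enum-map suc-injective (enum-upTo n))
  where
  unsuc : ∀ {x} → Image suc (_< n) x → 0 < x × x ≤ n
  unsuc (k , k<n , refl) = s≤s z≤n , k<n
  suc⁺ : ∀ x → 0 < x × x ≤ n → Image suc (_< n) x
  suc⁺ (suc k) (_ , k<n) = k , k<n , refl

All-reverse : ∀ {xs} → All P xs → All P (reverse xs)
All-reverse {xs = xs} = All-resp-↭ (↭-sym (↭-reverse xs))

AllPairs-reverse : {R : A → A → Set} → ∀ {xs} → AllPairs R xs → AllPairs (flip R) (reverse xs)
AllPairs-reverse {xs = []}     []         = []
AllPairs-reverse {xs = x ∷ xs} (Rx ∷ Rxs) rewrite unfold-reverse x xs =
  AllPairsₚ.++⁺ (AllPairs-reverse Rxs) ([] ∷ []) (All-reverse (All.map (_∷ []) Rx))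

∑< : ℕ → (ℕ → ℕ) → ℕ
∑< n f = sum (map f (upTo n))

∑<-cong : ∀ n {f g : ℕ → ℕ} → (∀ k → f k ≡ g k) → ∑< n f ≡ ∑< n g
∑<-cong n f≗g = cong sum (map-cong f≗g (upTo n))

∑<-const-0 : ∀ n → ∑< n (λ _ → 0) ≡ 0
∑<-const-0 n = go (upTo n)
  where
  go : (ks : List ℕ) → sum (map (λ _ → 0) ks) ≡ 0
  go []       = refl
  go (_ ∷ ks) = go ks

∑<-+ : ∀ n (f g : ℕ → ℕ) → ∑< n (λ k → f k + g k) ≡ ∑< n f + ∑< n g
∑<-+ n f g = go (upTo n)
  where
  go : (ks : List ℕ) → sum (map (λ k → f k + g k) ks) ≡ sum (map f ks) + sum (map g ks)
  go []       = refl
  go (k ∷ ks) = trans (cong (f k + g k +_) (go ks))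
                      (+-interchange (f k) (g k) (sum (map f ks)) (sum (map g ks)))

∑<-suc : ∀ n (f : ℕ → ℕ) → ∑< (suc n) f ≡ f 0 + ∑< n (f ∘ suc)
∑<-suc n f = cong (λ ks → f 0 + sum ks)
  (trans (map-applyUpTo suc f n) (sym (map-applyUpTo id (f ∘ suc) n)))

∑<-snoc : ∀ n (f : ℕ → ℕ) → ∑< (suc n) f ≡ ∑< n f + f n
∑<-snoc n f = begin
  sum (map f (upTo (suc n)))          ≡⟨ cong (sum ∘ map f) (upTo-∷ʳ n) ⟨
  sum (map f (upTo n ++ [ n ]))       ≡⟨ cong sum (map-++ f (upTo n) [ n ]) ⟩
  sum (map f (upTo n) ++ [ f n ])     ≡⟨ sum-++ (map f (upTo n)) [ f n ] ⟩
  ∑< n f + (f n + 0)                  ≡⟨ cong (∑< n f +_) (+-identityʳ (f n)) ⟩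
  ∑< n f + f n                        ∎
  where open ≡-Reasoning

pascal : ∀ n k → suc n C suc k ≡ n C k + n C suc k
pascal n k = sym (nCk+nC[k+1]≡[n+1]C[k+1] n k)

rootedCount trapezoidCount longCount : ℕ → ℕ → ℕ
rootedCount i b    = ∑< i (λ k → b C suc (suc k))
trapezoidCount i c = ∑< i (λ k → c C suc k)
longCount a b      = ∑< (suc a) (λ i → rootedCount i b)

rootedCount-suc : ∀ i b → rootedCount i (suc b) ≡ trapezoidCount i b + rootedCount i b
rootedCount-suc i b = begin
  ∑< i (λ k → suc b C suc (suc k))          ≡⟨ ∑<-cong i (λ k → pascal b (suc k)) ⟩
  ∑< i (λ k → b C suc k + b C suc (suc k))  ≡⟨ ∑<-+ i (λ k → b C suc k) (λ k → b C suc (suc k)) ⟩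
  trapezoidCount i b + rootedCount i b      ∎
  where open ≡-Reasoning

trapezoidCount-suc : ∀ i c →
  trapezoidCount (suc i) (suc c) ≡ trapezoidCount i c + (suc c + rootedCount i c)
trapezoidCount-suc i c = begin
  ∑< (suc i) (λ k → suc c C suc k)
    ≡⟨ ∑<-cong (suc i) (pascal c) ⟩
  ∑< (suc i) (λ k → c C k + c C suc k)
    ≡⟨ ∑<-+ (suc i) (c C_) (λ k → c C suc k) ⟩
  ∑< (suc i) (c C_) + ∑< (suc i) (λ k → c C suc k)
    ≡⟨ cong₂ _+_ (∑<-suc i (c C_)) (∑<-suc i (λ k → c C suc k)) ⟩
  suc T + (c C 1 + R)
    ≡⟨ cong (λ n → suc T + (n + R)) (nC1≡n c) ⟩
  suc T + (c + R)
    ≡⟨ +-suc T (c + R) ⟨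
  T + (suc c + R)
    ∎
  where
  open ≡-Reasoning
  T R : ℕ
  T = trapezoidCount i c
  R = rootedCount i c

rhs≡longCount+a*b : ∀ a b → rhs a b ≡ longCount a b + a * b
rhs≡longCount+a*b a b =
  cong (_+ a * b) (∑<-cong (suc a) (λ i → ∑<-cong i (λ k → cong (b C_) (+-comm k 2))))

-- A matrix listed from its last row to its first.
Chain : List Row → Set
Chain = AllPairs (flip Before)

shift : Row → Row
shift (x , y) = suc x , y

shift-injective : Injective _≡_ _≡_ shift
shift-injective {_ , _} {_ , _} refl = refl

OffAxis : Row → Set
OffAxis (x , _) = 0 < x

InTrapezoid : ℕ → ℕ → Row → Set
InTrapezoid i c (x , y) = x < i × x + y < c

RootedChain : ℕ → ℕ → List Row → Set
RootedChain a b rows@((zero , _) ∷ _ ∷ _) = Chain rows × All (InBox a b) rows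
RootedChain a b _                          = ⊥

TrapezoidChain : ℕ → ℕ → List Row → Set
TrapezoidChain i c []           = ⊥
TrapezoidChain i c rows@(_ ∷ _) = Chain rows × All (InTrapezoid i c) rows

LongChain : ℕ → ℕ → List Row → Set
LongChain a b rows = 2 ≤ length rows × Chain rows × All (InBox a b) rows

hang : ℕ → List Row → List Row
hang b rows = (zero , suc b) ∷ map shift rows

onAxis : ℕ → List Row
onAxis y = [ (zero , y) ]

chain-shift : ∀ rows → Chain (map shift rows) ⇔ Chain rows
chain-shift rows = mk⇔
  (AllPairs.map (Product.map s≤s⁻¹ s≤s⁻¹) ∘ AllPairsₚ.map⁻)
  (AllPairsₚ.map⁺ ∘ AllPairs.map (Product.map s≤s s≤s))

All-shift : {P Q : Row → Set} → (∀ r → P (shift r) ⇔ Q r) →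
            ∀ rows → All P (map shift rows) ⇔ All Q rows
All-shift P⇔Q rows = mk⇔
  (All.map (λ {r} → to (P⇔Q r)) ∘ Allₚ.map⁻)
  (Allₚ.map⁺ ∘ All.map (λ {r} → from (P⇔Q r)))

chain⇒offAxis : ∀ {h rows} → Chain (h ∷ rows) → All OffAxis rows
chain⇒offAxis (h≺rows ∷ _) = All.map (λ (h<x , _) → ≤-trans (s≤s z≤n) h<x) h≺rows

unshift : ∀ {rows} → All OffAxis rows → ∃ λ t → map shift t ≡ rows
unshift []                                   = [] , refl
unshift {(suc x , y) ∷ _} (_ ∷ offAxis) with t , refl ← unshift offAxis = (x , y) ∷ t , refl

image-shift : (Q : List Row → Set) {P : List Row → Set} → (∀ t → Q (map shift t) → P t) →
              ∀ {rows} → All OffAxis rows → Q rows → Image (map shift) P rows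
image-shift Q Q⇒P offAxis q with t , refl ← unshift offAxis = t , Q⇒P t q , refl

trapezoidChain-shift : ∀ {i c} rows →
  TrapezoidChain (suc i) (suc c) (map shift rows) ⇔ TrapezoidChain i c rows
trapezoidChain-shift []            = mk⇔ id id
trapezoidChain-shift rows@(_ ∷ _) =
  chain-shift rows ×-⇔ All-shift (λ _ → mk⇔ (Product.map s≤s⁻¹ s≤s⁻¹) (Product.map s≤s s≤s)) rows

longChain-shift : ∀ {a b} rows → LongChain (suc a) b (map shift rows) ⇔ LongChain a b rows
longChain-shift rows =
  mk⇔ (subst (2 ≤_) (length-map shift rows)) (subst (2 ≤_) (sym (length-map shift rows))) ×-⇔
  chain-shift rows ×-⇔ All-shift (λ _ → mk⇔ (Product.map₁ s≤s⁻¹) (Product.map₁ s≤s)) rows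

¬rootedChain-shift : ∀ {a b} rows → ¬ RootedChain a b (map shift rows)
¬rootedChain-shift []          ()
¬rootedChain-shift (_ ∷ [])    ()
¬rootedChain-shift (_ ∷ _ ∷ _) ()

rootedChain-hang : ∀ {i b} rows → RootedChain i (suc b) (hang b rows) ⇔ TrapezoidChain i b rows
rootedChain-hang          []            = mk⇔ id id
rootedChain-hang {i} {b} rows@(_ ∷ _) = mk⇔ unhang (λ (ch , trapezoid) → hang⁺ ch trapezoid)
  where
  belowApex⇔ : ∀ r →
    (Before (shift r) (zero , suc b) × InBox i (suc b) (shift r)) ⇔ InTrapezoid i b r
  belowApex⇔ (x , y) = mk⇔
    (λ ((_ , x+y<b) , (x<i , _)) → x<i , s≤s⁻¹ x+y<b)
    (λ (x<i , x+y<b) → (s≤s z≤n , s≤s x+y<b) , (x<i , ≤-trans (m≤n+m y x) (m<n⇒m≤1+n x+y<b)))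
  unhang : RootedChain i (suc b) (hang b rows) → TrapezoidChain i b rows
  unhang ((belowApex ∷ ch) , (_ ∷ box)) =
    to (chain-shift rows) ch , to (All-shift belowApex⇔ rows) (All.zip (belowApex , box))
  hang⁺ : Chain rows → All (InTrapezoid i b) rows → RootedChain i (suc b) (hang b rows)
  hang⁺ ch trapezoid with belowApex , box ← All.unzip (from (All-shift belowApex⇔ rows) trapezoid) =
    (belowApex ∷ from (chain-shift rows) ch) , ((z≤n , ≤-refl) ∷ box)

rootedChain-split : ∀ {i b} rows →
  RootedChain i (suc b) rows ⇔ (Image (hang b) (TrapezoidChain i b) rows ⊎ RootedChain i b rows)
rootedChain-split {i} {b} rows = mk⇔ (split rows) join
  where
  lower : ∀ {y} r → Before r (zero , y) → y ≤ b → InBox i (suc b) r → InBox i b r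
  lower (x , y′) (_ , x+y′<y) y≤b (x≤i , _) =
    x≤i , ≤-trans (m≤n+m y′ x) (<⇒≤ (<-≤-trans x+y′<y y≤b))
  Pieces : List Row → Set
  Pieces rows = Image (hang b) (TrapezoidChain i b) rows ⊎ RootedChain i b rows
  split : ∀ rows → RootedChain i (suc b) rows → Pieces rows
  split ((zero , y) ∷ _ ∷ _) rooted@(ch@(below ∷ _) , (_ , y≤1+b) ∷ box)
    with m≤n⇒m<n∨m≡n y≤1+b
  ... | inj₁ (s≤s y≤b) =
    inj₂ (ch , (z≤n , y≤b) ∷ All.zipWith (λ {r} (r≺ , r∈) → lower r r≺ y≤b r∈) (below , box))
  ... | inj₂ refl = inj₁ (Product.map₂ (Product.map₂ (cong ((zero , suc b) ∷_)))
    (image-shift (λ rest → RootedChain i (suc b) ((zero , suc b) ∷ rest))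
                 (λ t → to (rootedChain-hang t)) (chain⇒offAxis ch) rooted))
  join : ∀ {rows} → Pieces rows → RootedChain i (suc b) rows
  join (inj₁ (t , trapezoid , refl))          = from (rootedChain-hang t) trapezoid
  join {(zero , _) ∷ _ ∷ _} (inj₂ (ch , box)) = ch , All.map (Product.map₂ m≤n⇒m≤1+n) box

trapezoidChain-split : ∀ {i c} rows →
  TrapezoidChain (suc i) (suc c) rows ⇔
  (Image (map shift) (TrapezoidChain i c) rows ⊎
   (Image onAxis (_< suc c) rows ⊎ RootedChain i c rows))
trapezoidChain-split {i} {c} rows = mk⇔ (split rows) join
  where
  toBox : ∀ r → InTrapezoid (suc i) (suc c) r → InBox i c r
  toBox (x , y) (x<1+i , x+y<1+c) = s≤s⁻¹ x<1+i , ≤-trans (m≤n+m y x) (s≤s⁻¹ x+y<1+c)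
  fromBox : ∀ {y} r → Before r (zero , y) → y ≤ c → InBox i c r → InTrapezoid (suc i) (suc c) r
  fromBox (x , _) (_ , x+y′<y) y≤c (x≤i , _) = s≤s x≤i , m<n⇒m<1+n (<-≤-trans x+y′<y y≤c)
  Pieces : List Row → Set
  Pieces rows =
    Image (map shift) (TrapezoidChain i c) rows ⊎
    (Image onAxis (_< suc c) rows ⊎ RootedChain i c rows)
  split : ∀ rows → TrapezoidChain (suc i) (suc c) rows → Pieces rows
  split ((suc _ , _) ∷ _) trapezoid@(ch , _) = inj₁
    (image-shift (TrapezoidChain (suc i) (suc c)) (λ t → to (trapezoidChain-shift t))
                 (s≤s z≤n ∷ chain⇒offAxis ch) trapezoid)
  split ((zero , y) ∷ []) (_ , (_ , y<1+c) ∷ []) = inj₂ (inj₁ (y , y<1+c , refl))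
  split ((zero , y) ∷ _ ∷ _) (ch , (_ , y<1+c) ∷ trapezoid) =
    inj₂ (inj₂ (ch , (z≤n , s≤s⁻¹ y<1+c) ∷ All.map (λ {r} → toBox r) trapezoid))
  join : ∀ {rows} → Pieces rows → TrapezoidChain (suc i) (suc c) rows
  join (inj₁ (t , trapezoid , refl))    = from (trapezoidChain-shift t) trapezoid
  join (inj₂ (inj₁ (y , y<1+c , refl))) = [] ∷ [] , (s≤s z≤n , y<1+c) ∷ []
  join {(zero , _) ∷ _ ∷ _} (inj₂ (inj₂ (ch@(below ∷ _) , (_ , y≤c) ∷ box))) =
    ch , (s≤s z≤n , s≤s y≤c) ∷ All.zipWith (λ {r} (r≺ , r∈) → fromBox r r≺ y≤c r∈) (below , box)

longChain-split : ∀ {a b} rows →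
  LongChain (suc a) b rows ⇔ (Image (map shift) (LongChain a b) rows ⊎ RootedChain (suc a) b rows)
longChain-split {a} {b} rows = mk⇔ (split rows) join
  where
  Pieces : List Row → Set
  Pieces rows = Image (map shift) (LongChain a b) rows ⊎ RootedChain (suc a) b rows
  split : ∀ rows → LongChain (suc a) b rows → Pieces rows
  split []       (() , _)
  split (_ ∷ []) (s≤s () , _)
  split ((zero , _) ∷ _ ∷ _) (_ , rooted) = inj₂ rooted
  split ((suc _ , _) ∷ _ ∷ _) long@(_ , ch , _) = inj₁
    (image-shift (LongChain (suc a) b) (λ t → to (longChain-shift t))
                 (s≤s z≤n ∷ chain⇒offAxis ch) long)
  join : ∀ {rows} → Pieces rows → LongChain (suc a) b rows
  join (inj₁ (t , long , refl))           = from (longChain-shift t) long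
  join {(zero , _) ∷ _ ∷ _} (inj₂ rooted) = s≤s (s≤s z≤n) , rooted

¬rootedChain-0 : ∀ {i} rows → ¬ RootedChain i 0 rows
¬rootedChain-0 ((zero , _) ∷ _ ∷ _) ((((_ , x+y<y₀) ∷ _) ∷ _) , (_ , y₀≤0) ∷ _) =
  n≮0 (<-≤-trans x+y<y₀ y₀≤0)

¬trapezoidChain-0ˡ : ∀ {c} rows → ¬ TrapezoidChain 0 c rows
¬trapezoidChain-0ˡ (_ ∷ _) (_ , (() , _) ∷ _)

¬trapezoidChain-0ʳ : ∀ {i} rows → ¬ TrapezoidChain i 0 rows
¬trapezoidChain-0ʳ (_ ∷ _) (_ , (_ , ()) ∷ _)

¬longChain-0 : ∀ {b} rows → ¬ LongChain 0 b rows
¬longChain-0 []          (() , _)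
¬longChain-0 (_ ∷ [])    (s≤s () , _)
¬longChain-0 (_ ∷ _ ∷ _) (_ , ((x<x′ , _) ∷ _) ∷ _ , _ ∷ (x′≤0 , _) ∷ _) = n≮0 (<-≤-trans x<x′ x′≤0)

hang-injective : ∀ {b} → Injective _≡_ _≡_ (hang b)
hang-injective = map-injective shift-injective ∘ ∷-injectiveʳ

mutual
  enum-rootedChain : ∀ i b → Enumeration (RootedChain i b) (rootedCount i b)
  -- 0 C suc k computes to 0, so rootedCount i 0 is ∑< i (λ _ → 0).
  enum-rootedChain i zero =
    subst (Enumeration _) (sym (∑<-const-0 i)) (enum-∅ ¬rootedChain-0)
  enum-rootedChain i (suc b) =
    subst (Enumeration _) (sym (rootedCount-suc i b)) (enum-⇔ (⇔-sym ∘ rootedChain-split)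
      (enum-⊎ disjoint (enum-map hang-injective (enum-trapezoidChain i b)) (enum-rootedChain i b)))
    where
    disjoint : ∀ {rows} → Image (hang b) (TrapezoidChain i b) rows → ¬ RootedChain i b rows
    disjoint (_ ∷ _ , _ , refl) (_ , (_ , 1+b≤b) ∷ _) = n≮n b 1+b≤b

  enum-trapezoidChain : ∀ i c → Enumeration (TrapezoidChain i c) (trapezoidCount i c)
  enum-trapezoidChain zero c = enum-∅ ¬trapezoidChain-0ˡ
  enum-trapezoidChain (suc i) zero =
    subst (Enumeration _) (sym (∑<-const-0 (suc i))) (enum-∅ ¬trapezoidChain-0ʳ)
  enum-trapezoidChain (suc i) (suc c) =
    subst (Enumeration _) (sym (trapezoidCount-suc i c)) (enum-⇔ (⇔-sym ∘ trapezoidChain-split)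
      (enum-⊎ shifted-disjoint (enum-map (map-injective shift-injective) (enum-trapezoidChain i c))
        (enum-⊎ axis-disjoint (enum-map (cong proj₂ ∘ ∷-injectiveˡ) (enum-upTo (suc c)))
                              (enum-rootedChain i c))))
    where
    axis-disjoint : ∀ {rows} → Image onAxis (_< suc c) rows → ¬ RootedChain i c rows
    axis-disjoint (_ , _ , refl) ()
    shifted-disjoint : ∀ {rows} → Image (map shift) (TrapezoidChain i c) rows →
                       ¬ (Image onAxis (_< suc c) rows ⊎ RootedChain i c rows)
    shifted-disjoint (_ ∷ _ , _ , refl) (inj₁ (_ , _ , ()))
    shifted-disjoint (t , _ , refl)     (inj₂ rooted) = ¬rootedChain-shift t rooted

enum-longChain : ∀ a b → Enumeration (LongChain a b) (longCount a b)
enum-longChain zero b = enum-∅ ¬longChain-0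
enum-longChain (suc a) b =
  subst (Enumeration _) (sym (∑<-snoc (suc a) (λ i → rootedCount i b)))
    (enum-⇔ (⇔-sym ∘ longChain-split)
      (enum-⊎ disjoint (enum-map (map-injective shift-injective) (enum-longChain a b))
                       (enum-rootedChain (suc a) b)))
  where
  disjoint : ∀ {rows} → Image (map shift) (LongChain a b) rows → ¬ RootedChain (suc a) b rows
  disjoint (t , _ , refl) = ¬rootedChain-shift t

SingleRow : ℕ → ℕ → Row → Set
SingleRow a b p = Valid a b [ p ]

enum-singleRow : ∀ a b → Enumeration (SingleRow a b) (a * b)
enum-singleRow a b = enum-⇔
  (λ _ → mk⇔ (λ ((0<x , x≤a) , y<b) → (x≤a , <⇒≤ y<b) , 0<x , y<b)
             (λ ((x≤a , _) , 0<x , y<b) → (0<x , x≤a) , y<b))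
  (enum-× (enum-positive≤ a) (enum-upTo b))

valid-split : ∀ {a b} m →
  Valid a b m ⇔ (Image reverse (LongChain a b) m ⊎ Image [_] (SingleRow a b) m)
valid-split {a} {b} m = mk⇔ (split m) join
  where
  2≤|reverse| : ∀ xs → 2 ≤ length xs → 2 ≤ length (reverse xs)
  2≤|reverse| xs = subst (2 ≤_) (sym (length-reverse xs))
  valid-long : ∀ m → 2 ≤ length m → All (InBox a b) m → AllPairs Before m → Valid a b m
  valid-long (_ ∷ _ ∷ _) _ box before = box , before
  valid-long (_ ∷ [])    (s≤s ())
  split : ∀ m → Valid a b m → Image reverse (LongChain a b) m ⊎ Image [_] (SingleRow a b) m
  split (p ∷ []) single = inj₂ (p , single , refl)
  split m@(_ ∷ _ ∷ _) (box , before) = inj₁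
    (reverse m , (2≤|reverse| m (s≤s (s≤s z≤n)) , AllPairs-reverse before , All-reverse box) ,
     reverse-involutive m)
  join : ∀ {m} → Image reverse (LongChain a b) m ⊎ Image [_] (SingleRow a b) m → Valid a b m
  join (inj₁ (rows , (2≤|rows| , ch , box) , refl)) =
    valid-long (reverse rows) (2≤|reverse| rows 2≤|rows|) (All-reverse box) (AllPairs-reverse ch)
  join (inj₂ (_ , single , refl)) = single

lemma2 : (a b : ℕ) →
    Σ (List (List Row)) (λ L →
      Unique L × ((m : List Row) → (m ∈ L) ⇔ Valid a b m) × length L ≡ rhs a b)
lemma2 a b =
  subst (Enumeration (Valid a b)) (sym (rhs≡longCount+a*b a b))
    (enum-⇔ (⇔-sym ∘ valid-split)
      (enum-⊎ disjoint (enum-map reverse-injective (enum-longChain a b))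
                       (enum-map ∷-injectiveˡ (enum-singleRow a b))))
  where
  disjoint : ∀ {m} → Image reverse (LongChain a b) m → ¬ Image [_] (SingleRow a b) m
  disjoint (rows , (2≤|rows| , _) , refl) (_ , _ , [p]≡rev) =
    n≮n 1 (subst (2 ≤_) (trans (sym (length-reverse rows)) (cong length (sym [p]≡rev))) 2≤|rows|)
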